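{- Let $V$ be a finite set of boxes, let $w:V\to[0,1]^d$ be a size function, and let $w':V\to\mathbb R_{\ge 0}^d$ be a conservative scale for $(V,w)$. If there exists a packing class for $(V,w)$, then $$\sum_{b\in V}\prod_{i=1}^d w'_i(b)\le 1.$$
   Context: The container is the unit cube $[0,1]^d$; box $b$ has extent $w_i(b)$ in direction $i$. For a size function $w$, $\mathcal F(V,w_i)=\{S\subseteq V:\sum_{b\in S}w_i(b)\le 1\}$. A function $w'$ is a conservative scale for $(V,w)$ if $\mathcal F(V,w_i)\subseteq\mathcal F(V,w'_i)$ for all $i=1,\dots,d$. A packing class for $(V,w)$ is a $d$-tuple of graphs $G_i=(V,E_i)$ such that each $G_i$ is an interval graph, every stable set of $G_i$ lies in $\mathcal F(V,w_i)$, and $\bigcap_{i=1}^d E_i=\emptyset$. (Existence of a packing class for $(V,w)$ is equivalent to existence of a feasible orthogonal packing of the boxes with sizes $w$ into the unit cube, with fixed orientations and disjoint interiors.) -}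

module Defs where

open import Level using (Level; suc; _⊔_)
open import Data.Nat using (ℕ)
open import Data.Fin using (Fin)
import Data.Fin as F
open import Data.Fin.Subset using (Subset; _∈_)
open import Data.Vec using ([]; _∷_)
open import Data.Bool using (true; false)
open import Data.Product using (_×_; Σ-syntax)
open import Relation.Nullary using (¬_)
open import Relation.Binary.PropositionalEquality using (_≡_; _≢_)
import Algebra.Structures as AS
import Relation.Binary.Structures as RS
open import Function.Bundles using (_⇔_)

-- Agda's standard library has no real numbers, so the
-- statement is made for an arbitrary (totally) ordered commutative ring
-- K (with propositional equality); ℝ is one instance.  Only +, *, 0, 1
-- and ≤ occur in the statement.

record OrderedCommRing : Set₁ where
  infixl 6 _+_
  infixl 7 _*_
  infix 4 _≤_ _<_
  field
    Carrier : Set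
    _+_ _*_ : Carrier → Carrier → Carrier
    -_      : Carrier → Carrier
    0# 1#   : Carrier
    isCommutativeRing : AS.IsCommutativeRing {A = Carrier} _≡_ _+_ _*_ -_ 0# 1#
    _≤_     : Carrier → Carrier → Set
    isTotalOrder : RS.IsTotalOrder {A = Carrier} _≡_ _≤_
    +-mono-≤ : ∀ {x y} z → x ≤ y → x + z ≤ y + z
  _<_ : Carrier → Carrier → Set
  x < y = x ≤ y × x ≢ y
  field
    *-pos    : ∀ {x y} → 0# < x → 0# < y → 0# < x * y
    0<1      : 0# < 1#

module _ (K : OrderedCommRing) where
  open OrderedCommRing K

  sumOver : ∀ {n} → Subset n → (Fin n → Carrier) → Carrier
  sumOver []          f = 0#
  sumOver (true  ∷ S) f = f F.zero + sumOver S (λ j → f (F.suc j))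
  sumOver (false ∷ S) f = sumOver S (λ j → f (F.suc j))

  sumAll : ∀ n → (Fin n → Carrier) → Carrier
  sumAll ℕ.zero    f = 0#
  sumAll (ℕ.suc n) f = f F.zero + sumAll n (λ j → f (F.suc j))

  prodAll : ∀ d → (Fin d → Carrier) → Carrier
  prodAll ℕ.zero    f = 1#
  prodAll (ℕ.suc d) f = f F.zero * prodAll d (λ j → f (F.suc j))

  -- 𝓕(V, wᵢ) : subsets S with Σ_{b∈S} wᵢ(b) ≤ 1, for V = Fin n
  -- a size function is  w : V → K^d, written  w : Fin n → Fin d → Carrier
  InF : ∀ {n d} → (Fin n → Fin d → Carrier) → Fin d → Subset n → Set
  InF w i S = sumOver S (λ b → w b i) ≤ 1#

  SizeFunction : ∀ n d → (Fin n → Fin d → Carrier) → Set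
  SizeFunction n d w = ∀ b i → (0# ≤ w b i) × (w b i ≤ 1#)

  NonNeg : ∀ n d → (Fin n → Fin d → Carrier) → Set
  NonNeg n d w' = ∀ b i → 0# ≤ w' b i

  ConservativeScale : ∀ {n d} → (w w' : Fin n → Fin d → Carrier) → Set
  ConservativeScale {n} {d} w w' = ∀ (i : Fin d) (S : Subset n) → InF w i S → InF w' i S

record Graph (n : ℕ) : Set₁ where
  field
    Edge      : Fin n → Fin n → Set
    irrefl    : ∀ u → ¬ Edge u u
    symmetric : ∀ u v → Edge u v → Edge v u
open Graph public

Stable : ∀ {n} → Graph n → Subset n → Set
Stable G S = ∀ u v → u ∈ S → v ∈ S → ¬ Edge G u v

module _ (K : OrderedCommRing) where
  open OrderedCommRing K

  IsIntervalGraph : ∀ {n} → Graph n → Set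
  IsIntervalGraph {n} G =
    Σ[ l ∈ (Fin n → Carrier) ] Σ[ r ∈ (Fin n → Carrier) ]
      ((∀ v → l v ≤ r v) ×
       (∀ u v → u ≢ v → (Edge G u v ⇔ (l u ≤ r v × l v ≤ r u))))

  record PackingClass (n d : ℕ) (w : Fin n → Fin d → Carrier) : Set₁ where
    field
      G         : Fin d → Graph n
      interval  : ∀ i → IsIntervalGraph (G i)
      stableInF : ∀ i S → Stable (G i) S → InF K w i S
      noCommonEdge : ∀ u v → u ≢ v → ¬ (∀ i → Edge (G i) u v)

{-# OPTIONS --safe #-}
module Submission where

-- Fix interval representations of the graphs G i. Boxes whose i-th intervals are pairwise
-- disjoint (a chain of the interval order) form a stable set of G i, so their w′ᵢ-weights sum to
-- at most 1; and distinct boxes have disjoint intervals in some coordinate, as the G i share no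
-- edge. The bound then follows by induction on d from a product inequality for one interval
-- order: if every chain has x-weight at most A and every antichain (pairwise intersecting
-- intervals) has y-weight at most B, then Σ x y ≤ A B. For this, let u be the interval ending
-- first, C the intervals starting before u ends (an antichain: all contain the right end of u)
-- and c the least x-weight on C. Lowering x by c on C lowers every chain bound by c, since a
-- chain meets C at most once and a chain missing C extends by u; it also zeroes the minimiser,
-- so induction on the set gives Σ x y ≤ (A - c) B + c B.

open import Algebra.Bundles using (CommutativeRing)
import Algebra.Properties.CommutativeSemigroup as CommutativeSemigroupProperties
import Algebra.Properties.Group as GroupProperties
import Algebra.Structures as AS
open import Data.Bool using (if_then_else_)
open import Data.Bool.Properties using (¬-not)
open import Data.Empty using (⊥-elim)
open import Data.Fin using (Fin; zero; suc)
import Data.Fin as Fin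
open import Data.Fin.Properties using (¬∀⟶∃¬)
open import Data.Fin.Subset
  using (Subset; inside; outside; _∈_; _∉_; _⊆_; _⊂_; _∩_; _∪_; _─_; ⊥; ⊤; ⁅_⁆; Nonempty; Empty)
open import Data.Fin.Subset.Induction using (Acc; acc; ⊂-wellFounded)
open import Data.Fin.Subset.Properties
  using (_∈?_; nonempty?; Empty-unique; ∉⊥; ⊥⊆; ⊆-antisym; ⊆-trans; x∈⁅x⁆; x∈⁅y⁆⇒x≡y;
         x∈p∩q⁺; x∈p∩q⁻; p∩q⊆p; p∩q⊆q; x∈p∪q⁻; p─⊥≡p; p─q⊆p; x∈p⇒p-x⊂p)
open import Data.List using (List; filter; allFin)
import Data.List.Extrema as Extrema
open import Data.List.Membership.Propositional.Properties using (∈-filter⁺; ∈-allFin)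
import Data.List.Relation.Unary.All as All
open import Data.List.Relation.Unary.All.Properties using (all-filter)
open import Data.Nat using (ℕ; zero; suc)
open import Data.Product using (_×_; _,_; proj₁; proj₂; ∃-syntax)
open import Data.Sum using (_⊎_; inj₁; inj₂)
open import Data.Vec using ([]; _∷_; lookup; tabulate; here; there)
open import Data.Vec.Properties using ([]=⇒lookup; lookup⇒[]=; lookup∘tabulate)
open import Function using (_∘_)
open import Function.Bundles using (_⇔_; Equivalence)
import Function.Properties.Equivalence as ⇔
open import Relation.Binary using (Decidable)
open import Relation.Binary.Bundles using (TotalOrder)
import Relation.Binary.Properties.Poset as PosetProperties
import Relation.Binary.Properties.TotalOrder as TotalOrderProperties
open import Relation.Binary.PropositionalEquality
import Relation.Binary.Reasoning.PartialOrder as ≤-Reasoning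
import Relation.Binary.Structures as RS
open import Relation.Nullary using (¬_; Dec; yes; no; does)
open import Relation.Nullary.Decidable using (dec-true; _×-dec_)
import Relation.Nullary.Decidable as Dec
import Relation.Unary as U

open import Defs

module _ (K : OrderedCommRing) where
  open OrderedCommRing K
  open AS.IsCommutativeRing isCommutativeRing
    using (+-assoc; +-comm; +-identityˡ; +-identityʳ; -‿inverseʳ; *-assoc;
           *-identityˡ; *-identityʳ; zeroˡ; zeroʳ; distribˡ; distribʳ)
  open RS.IsTotalOrder isTotalOrder using (total; antisym; reflexive) renaming (trans to ≤-trans)

  ring : CommutativeRing _ _
  ring = record { isCommutativeRing = isCommutativeRing }

  totalOrder : TotalOrder _ _ _
  totalOrder = record { isTotalOrder = isTotalOrder }

  open GroupProperties (CommutativeRing.+-group ring) using (//-rightDividesˡ; //-rightDividesʳ)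
  open CommutativeSemigroupProperties (CommutativeRing.+-commutativeSemigroup ring)
    using (interchange; x∙yz≈y∙xz)
  open TotalOrderProperties totalOrder using (≰⇒>)
  open PosetProperties (TotalOrder.poset totalOrder) using (≤-dec⇒≈-dec; <⇒≱)
  open ≤-Reasoning (TotalOrder.poset totalOrder)

  infixl 6 _-_
  _-_ : Carrier → Carrier → Carrier
  x - y = x + - y

  -- total is a function, so at x ≡ y it cannot answer inj₂ for (x, y) and inj₁ for (y, x).
  _≤?_ : Decidable _≤_
  x ≤? y with total x y in xy | total y x in yx
  ... | inj₁ x≤y | _        = yes x≤y
  ... | inj₂ _   | inj₂ x≤y = yes x≤y
  ... | inj₂ y≤x | inj₁ _   = no λ x≤y → total-unambiguous xy yx (antisym x≤y y≤x)
    where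
      total-unambiguous : ∀ {a b p q} → total a b ≡ inj₂ p → total b a ≡ inj₁ q → a ≢ b
      total-unambiguous ab ba refl with () ← trans (sym ab) ba

  _≟_ : Decidable {A = Carrier} _≡_
  _≟_ = ≤-dec⇒≈-dec _≤?_

  +-monoʳ-≤ : ∀ z {x y} → x ≤ y → z + x ≤ z + y
  +-monoʳ-≤ z {x} {y} x≤y = subst₂ _≤_ (+-comm x z) (+-comm y z) (+-mono-≤ z x≤y)

  +-mono₂-≤ : ∀ {x y u v} → x ≤ y → u ≤ v → x + u ≤ y + v
  +-mono₂-≤ {y = y} {u} x≤y u≤v = ≤-trans (+-mono-≤ u x≤y) (+-monoʳ-≤ y u≤v)

  x≤y⇒0≤y-x : ∀ {x y} → x ≤ y → 0# ≤ y - x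
  x≤y⇒0≤y-x {x} {y} x≤y = subst (_≤ y - x) (-‿inverseʳ x) (+-mono-≤ (- x) x≤y)

  x+y≤z⇒x≤z-y : ∀ {x y z} → x + y ≤ z → x ≤ z - y
  x+y≤z⇒x≤z-y {x} {y} {z} x+y≤z = subst (_≤ z - y) (//-rightDividesʳ y x) (+-mono-≤ (- y) x+y≤z)

  *-nonneg : ∀ {x y} → 0# ≤ x → 0# ≤ y → 0# ≤ x * y
  *-nonneg {x} {y} 0≤x 0≤y with x ≟ 0# | y ≟ 0#
  ... | yes refl | _        = reflexive (sym (zeroˡ y))
  ... | no _     | yes refl = reflexive (sym (zeroʳ x))
  ... | no x≢0   | no y≢0   = proj₁ (*-pos (0≤x , x≢0 ∘ sym) (0≤y , y≢0 ∘ sym))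

  *-monoʳ-≤-nonneg : ∀ {z x y} → 0# ≤ z → x ≤ y → z * x ≤ z * y
  *-monoʳ-≤-nonneg {z} {x} {y} 0≤z x≤y = begin
    z * x               ≡⟨ +-identityˡ (z * x) ⟨
    0# + z * x          ≤⟨ +-mono-≤ (z * x) (*-nonneg 0≤z (x≤y⇒0≤y-x x≤y)) ⟩
    z * (y - x) + z * x ≡⟨ distribˡ z (y - x) x ⟨
    z * (y - x + x)     ≡⟨ cong (z *_) (//-rightDividesˡ x y) ⟩
    z * y               ∎

  [x-y]z+yz≡xz : ∀ x y z → (x - y) * z + y * z ≡ x * z
  [x-y]z+yz≡xz x y z = trans (sym (distribʳ z (x - y) y)) (cong (_* z) (//-rightDividesˡ y x))

  toSubset : ∀ {n p} {P : U.Pred (Fin n) p} → U.Decidable P → Subset n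
  toSubset P? = tabulate (does ∘ P?)

  ∈-toSubset⁺ : ∀ {n p} {P : U.Pred (Fin n) p} (P? : U.Decidable P) {b} → P b → b ∈ toSubset P?
  ∈-toSubset⁺ P? {b} Pb = lookup⇒[]= b _ (trans (lookup∘tabulate (does ∘ P?) b) (dec-true (P? b) Pb))

  ∈-toSubset⁻ : ∀ {n p} {P : U.Pred (Fin n) p} (P? : U.Decidable P) {b} → b ∈ toSubset P? → P b
  ∈-toSubset⁻ P? {b} b∈ with P? b | trans (sym (lookup∘tabulate (does ∘ P?) b)) ([]=⇒lookup b∈)
  ... | yes Pb | _ = Pb
  ... | no _   | ()

  subsingleton-cases : ∀ {n} (P : Subset n) → (∀ {a b} → a ∈ P → b ∈ P → a ≡ b) →
                       P ≡ ⊥ ⊎ ∃[ v ] P ≡ ⁅ v ⁆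
  subsingleton-cases P unique with nonempty? P
  ... | no P-empty        = inj₁ (Empty-unique P-empty)
  ... | yes (v , v∈P) = inj₂ (v , ⊆-antisym P⊆⁅v⁆ ⁅v⁆⊆P)
    where
      P⊆⁅v⁆ : P ⊆ ⁅ v ⁆
      P⊆⁅v⁆ a∈P = subst (_∈ ⁅ v ⁆) (unique v∈P a∈P) (x∈⁅x⁆ v)
      ⁅v⁆⊆P : ⁅ v ⁆ ⊆ P
      ⁅v⁆⊆P a∈⁅v⁆ = subst (_∈ P) (sym (x∈⁅y⁆⇒x≡y v a∈⁅v⁆)) v∈P

  ∃-minimiser : ∀ {n} (f : Fin n → Carrier) {S : Subset n} → Nonempty S →
                ∃[ u ] u ∈ S × (∀ {b} → b ∈ S → f u ≤ f b)
  ∃-minimiser {n} f {S} (v , v∈S) = u , argmin-all f v∈S (all-filter (_∈? S) (allFin n)) , u-minimal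
    where
      open Extrema totalOrder using (argmin; argmin-all; f[argmin]≤f[xs])
      members : List (Fin n)
      members = filter (_∈? S) (allFin n)
      u : Fin n
      u = argmin f v members
      u-minimal : ∀ {b} → b ∈ S → f u ≤ f b
      u-minimal b∈S = All.lookup (f[argmin]≤f[xs] v members) (∈-filter⁺ (_∈? S) (∈-allFin _) b∈S)

  χ : ∀ {n} → Subset n → Fin n → Carrier
  χ C b = if lookup C b then 1# else 0#

  χ-∈ : ∀ {n} {C : Subset n} {b} → b ∈ C → χ C b ≡ 1#
  χ-∈ b∈C = cong (if_then 1# else 0#) ([]=⇒lookup b∈C)

  χ-∉ : ∀ {n} {C : Subset n} {b} → b ∉ C → χ C b ≡ 0#
  χ-∉ {C = C} {b} b∉C = cong (if_then 1# else 0#) (¬-not (b∉C ∘ lookup⇒[]= b C))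

  sumOver-cong : ∀ {n} (S : Subset n) {f g : Fin n → Carrier} →
                 (∀ {b} → b ∈ S → f b ≡ g b) → sumOver K S f ≡ sumOver K S g
  sumOver-cong []            f≗g = refl
  sumOver-cong (inside ∷ S)  f≗g = cong₂ _+_ (f≗g here) (sumOver-cong S (f≗g ∘ there))
  sumOver-cong (outside ∷ S) f≗g = sumOver-cong S (f≗g ∘ there)

  sumOver-⊥ : ∀ n (f : Fin n → Carrier) → sumOver K ⊥ f ≡ 0#
  sumOver-⊥ zero    f = refl
  sumOver-⊥ (suc n) f = sumOver-⊥ n (f ∘ suc)

  sumOver-⊤ : ∀ n (f : Fin n → Carrier) → sumOver K ⊤ f ≡ sumAll K n f
  sumOver-⊤ zero    f = refl
  sumOver-⊤ (suc n) f = cong (f zero +_) (sumOver-⊤ n (f ∘ suc))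

  sumOver-⁅⁆ : ∀ {n} (v : Fin n) (f : Fin n → Carrier) → sumOver K ⁅ v ⁆ f ≡ f v
  sumOver-⁅⁆ zero    f = trans (cong (f zero +_) (sumOver-⊥ _ (f ∘ suc))) (+-identityʳ (f zero))
  sumOver-⁅⁆ (suc v) f = sumOver-⁅⁆ v (f ∘ suc)

  sumOver-+ : ∀ {n} (S : Subset n) (f g : Fin n → Carrier) →
              sumOver K S (λ b → f b + g b) ≡ sumOver K S f + sumOver K S g
  sumOver-+ []            f g = sym (+-identityʳ 0#)
  sumOver-+ (inside ∷ S)  f g = trans (cong (f zero + g zero +_) (sumOver-+ S (f ∘ suc) (g ∘ suc)))
                                      (interchange (f zero) (g zero) _ _)
  sumOver-+ (outside ∷ S) f g = sumOver-+ S (f ∘ suc) (g ∘ suc)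

  sumOver-*ˡ : ∀ {n} (S : Subset n) (c : Carrier) (f : Fin n → Carrier) →
               sumOver K S (λ b → c * f b) ≡ c * sumOver K S f
  sumOver-*ˡ []            c f = sym (zeroʳ c)
  sumOver-*ˡ (inside ∷ S)  c f = trans (cong (c * f zero +_) (sumOver-*ˡ S c (f ∘ suc)))
                                       (sym (distribˡ c (f zero) _))
  sumOver-*ˡ (outside ∷ S) c f = sumOver-*ˡ S c (f ∘ suc)

  sumOver-χ : ∀ {n} (S C : Subset n) (f : Fin n → Carrier) →
              sumOver K S (λ b → χ C b * f b) ≡ sumOver K (S ∩ C) f
  sumOver-χ []            []            f = refl
  sumOver-χ (inside ∷ S)  (inside ∷ C)  f = cong₂ _+_ (*-identityˡ (f zero)) (sumOver-χ S C (f ∘ suc))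
  sumOver-χ (inside ∷ S)  (outside ∷ C) f =
    trans (cong₂ _+_ (zeroˡ (f zero)) (sumOver-χ S C (f ∘ suc))) (+-identityˡ _)
  sumOver-χ (outside ∷ S) (_ ∷ C)       f = sumOver-χ S C (f ∘ suc)

  sumOver-∪ : ∀ {n} (S S′ : Subset n) (f : Fin n → Carrier) → (∀ {b} → b ∈ S → b ∉ S′) →
              sumOver K (S ∪ S′) f ≡ sumOver K S f + sumOver K S′ f
  sumOver-∪ []            []             f disjoint = sym (+-identityʳ 0#)
  sumOver-∪ (inside ∷ S)  (inside ∷ S′)  f disjoint = ⊥-elim (disjoint here here)
  sumOver-∪ (inside ∷ S)  (outside ∷ S′) f disjoint =
    trans (cong (f zero +_) (sumOver-∪ S S′ (f ∘ suc) (λ b∈S → disjoint (there b∈S) ∘ there)))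
          (sym (+-assoc _ _ _))
  sumOver-∪ (outside ∷ S) (inside ∷ S′)  f disjoint =
    trans (cong (f zero +_) (sumOver-∪ S S′ (f ∘ suc) (λ b∈S → disjoint (there b∈S) ∘ there)))
          (x∙yz≈y∙xz _ _ _)
  sumOver-∪ (outside ∷ S) (outside ∷ S′) f disjoint =
    sumOver-∪ S S′ (f ∘ suc) (λ b∈S → disjoint (there b∈S) ∘ there)

  sumOver-remove : ∀ {n} {S : Subset n} {u} (f : Fin n → Carrier) → u ∈ S →
                   sumOver K S f ≡ sumOver K (S ─ ⁅ u ⁆) f + f u
  sumOver-remove {S = inside ∷ S}  f here =
    trans (+-comm _ _) (cong (λ T → sumOver K T (f ∘ suc) + f zero) (sym (p─⊥≡p S)))
  sumOver-remove {S = inside ∷ S}  f (there u∈S) =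
    trans (cong (f zero +_) (sumOver-remove (f ∘ suc) u∈S)) (sym (+-assoc _ _ _))
  sumOver-remove {S = outside ∷ S} f (there u∈S) = sumOver-remove (f ∘ suc) u∈S

  sumOver-drop : ∀ {n} {S : Subset n} {u} (f : Fin n → Carrier) → u ∈ S → f u ≡ 0# →
                 sumOver K S f ≡ sumOver K (S ─ ⁅ u ⁆) f
  sumOver-drop {S = S} {u} f u∈S fu≡0 =
    trans (sumOver-remove f u∈S) (trans (cong (sumOver K (S ─ ⁅ u ⁆) f +_) fu≡0) (+-identityʳ _))

  peel : ∀ {n} → Subset n → Carrier → (Fin n → Carrier) → Fin n → Carrier
  peel C c x b = x b - c * χ C b

  peel-nonneg : ∀ {n} {T C : Subset n} {c x} → (∀ {b} → b ∈ T → 0# ≤ x b) →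
                (∀ {b} → b ∈ C → c ≤ x b) → ∀ {b} → b ∈ T → 0# ≤ peel C c x b
  peel-nonneg {C = C} {c} {x} x≥0 c≤x {b} b∈T = x≤y⇒0≤y-x c*χ≤x
    where
      c*χ≤x : c * χ C b ≤ x b
      c*χ≤x with b ∈? C
      ... | yes b∈C = begin
        c * χ C b ≡⟨ cong (c *_) (χ-∈ b∈C) ⟩
        c * 1#    ≡⟨ *-identityʳ c ⟩
        c         ≤⟨ c≤x b∈C ⟩
        x b       ∎
      ... | no b∉C = begin
        c * χ C b ≡⟨ cong (c *_) (χ-∉ b∉C) ⟩
        c * 0#    ≡⟨ zeroʳ c ⟩
        0#        ≤⟨ x≥0 b∈T ⟩
        x b       ∎

  peel-vanishes : ∀ {n} {C : Subset n} {x v} → v ∈ C → peel C (x v) x v ≡ 0#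
  peel-vanishes {C = C} {x} {v} v∈C = begin-equality
    x v - x v * χ C v ≡⟨ cong (λ e → x v - x v * e) (χ-∈ v∈C) ⟩
    x v - x v * 1#    ≡⟨ cong (λ e → x v - e) (*-identityʳ (x v)) ⟩
    x v - x v         ≡⟨ -‿inverseʳ (x v) ⟩
    0#                ∎

  sumOver-peel : ∀ {n} (S C : Subset n) (c : Carrier) (x f : Fin n → Carrier) →
                 sumOver K S (λ b → x b * f b) ≡
                 sumOver K S (λ b → peel C c x b * f b) + c * sumOver K (S ∩ C) f
  sumOver-peel S C c x f = begin-equality
    sumOver K S (λ b → x b * f b)
      ≡⟨ sumOver-cong S (λ {b} _ → split b) ⟩
    sumOver K S (λ b → x′ b * f b + c * (χ C b * f b))
      ≡⟨ sumOver-+ S _ _ ⟩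
    sumOver K S (λ b → x′ b * f b) + sumOver K S (λ b → c * (χ C b * f b))
      ≡⟨ cong (sumOver K S (λ b → x′ b * f b) +_) (sumOver-*ˡ S c _) ⟩
    sumOver K S (λ b → x′ b * f b) + c * sumOver K S (λ b → χ C b * f b)
      ≡⟨ cong (λ e → sumOver K S (λ b → x′ b * f b) + c * e) (sumOver-χ S C f) ⟩
    sumOver K S (λ b → x′ b * f b) + c * sumOver K (S ∩ C) f ∎
    where
      x′ : Fin _ → Carrier
      x′ = peel C c x
      split : ∀ b → x b * f b ≡ x′ b * f b + c * (χ C b * f b)
      split b = begin-equality
        x b * f b                      ≡⟨ cong (_* f b) (//-rightDividesˡ (c * χ C b) (x b)) ⟨
        (x′ b + c * χ C b) * f b       ≡⟨ distribʳ (f b) (x′ b) (c * χ C b) ⟩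
        x′ b * f b + c * χ C b * f b   ≡⟨ cong (x′ b * f b +_) (*-assoc c (χ C b) (f b)) ⟩
        x′ b * f b + c * (χ C b * f b) ∎

  sumOver-peel-remove : ∀ {n} {T C : Subset n} {v} (x f : Fin n → Carrier) → v ∈ T → v ∈ C →
                        sumOver K T (λ b → x b * f b) ≡
                        sumOver K (T ─ ⁅ v ⁆) (λ b → peel C (x v) x b * f b) + x v * sumOver K (T ∩ C) f
  sumOver-peel-remove {T = T} {C} {v} x f v∈T v∈C =
    trans (sumOver-peel T C (x v) x f) (cong (_+ x v * sumOver K (T ∩ C) f) (sumOver-drop _ v∈T x′v*fv≡0))
    where
      x′v*fv≡0 : peel C (x v) x v * f v ≡ 0#
      x′v*fv≡0 = trans (cong (_* f v) (peel-vanishes {x = x} v∈C)) (zeroˡ (f v))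

  prodAll-1 : ∀ d → prodAll K d (λ _ → 1#) ≡ 1#
  prodAll-1 zero    = refl
  prodAll-1 (suc d) = trans (cong (1# *_) (prodAll-1 d)) (*-identityʳ 1#)

  record Intervals (n : ℕ) : Set where
    field
      left right : Fin n → Carrier
      left≤right : ∀ b → left b ≤ right b

  -- Chains of the interval order ≺ are the stable sets of the interval graph, antichains its cliques.
  module _ {n} (I : Intervals n) where
    open Intervals I

    _≺_ : Fin n → Fin n → Set
    a ≺ b = right a < left b

    Apart : Fin n → Fin n → Set
    Apart a b = a ≺ b ⊎ b ≺ a

    Chain : Subset n → Set
    Chain S = ∀ {a b} → a ∈ S → b ∈ S → a ≢ b → Apart a b

    Antichain : Subset n → Set
    Antichain S = ∀ {a b} → a ∈ S → b ∈ S → ¬ a ≺ b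

    ChainBounded : Subset n → (Fin n → Carrier) → Carrier → Set
    ChainBounded T x A = ∀ {S} → S ⊆ T → Chain S → sumOver K S x ≤ A

    AntichainBounded : Subset n → (Fin n → Carrier) → Carrier → Set
    AntichainBounded T y B = ∀ {C} → C ⊆ T → Antichain C → sumOver K C y ≤ B

    ≺-irrefl : ∀ {a} → ¬ a ≺ a
    ≺-irrefl {a} a≺a = <⇒≱ a≺a (left≤right a)

    chain∩antichain-subsingleton : ∀ {S C} → Chain S → Antichain C →
                                   ∀ {a b} → a ∈ S ∩ C → b ∈ S ∩ C → a ≡ b
    chain∩antichain-subsingleton {S} {C} chain antichain {a} {b} a∈S∩C b∈S∩C with a Fin.≟ b
    ... | yes a≡b = a≡b
    ... | no a≢b with x∈p∩q⁻ S C a∈S∩C | x∈p∩q⁻ S C b∈S∩C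
    ...   | a∈S , a∈C | b∈S , b∈C with chain a∈S b∈S a≢b
    ...     | inj₁ a≺b = ⊥-elim (antichain a∈C b∈C a≺b)
    ...     | inj₂ b≺a = ⊥-elim (antichain b∈C a∈C b≺a)

    chain-∪-⁅⁆ : ∀ {S u} → Chain S → (∀ {b} → b ∈ S → u ≺ b) → Chain (S ∪ ⁅ u ⁆)
    chain-∪-⁅⁆ {S} {u} chain u≺S {a} {b} a∈ b∈ a≢b with x∈p∪q⁻ S ⁅ u ⁆ a∈ | x∈p∪q⁻ S ⁅ u ⁆ b∈
    ... | inj₁ a∈S | inj₁ b∈S = chain a∈S b∈S a≢b
    ... | inj₁ a∈S | inj₂ b∈u rewrite x∈⁅y⁆⇒x≡y u b∈u = inj₂ (u≺S a∈S)
    ... | inj₂ a∈u | inj₁ b∈S rewrite x∈⁅y⁆⇒x≡y u a∈u = inj₁ (u≺S b∈S)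
    ... | inj₂ a∈u | inj₂ b∈u = ⊥-elim (a≢b (trans (x∈⁅y⁆⇒x≡y u a∈u) (sym (x∈⁅y⁆⇒x≡y u b∈u))))

    chainBounded-extend : ∀ {T S u x A} → ChainBounded T x A → S ⊆ T → Chain S → u ∈ T →
                          (∀ {b} → b ∈ S → u ≺ b) → sumOver K S x + x u ≤ A
    chainBounded-extend {T} {S} {u} {x} {A} bounded S⊆T chain u∈T u≺S = begin
      sumOver K S x + x u               ≡⟨ cong (sumOver K S x +_) (sumOver-⁅⁆ u x) ⟨
      sumOver K S x + sumOver K ⁅ u ⁆ x ≡⟨ sumOver-∪ S ⁅ u ⁆ x disjoint ⟨
      sumOver K (S ∪ ⁅ u ⁆) x           ≤⟨ bounded S∪⁅u⁆⊆T (chain-∪-⁅⁆ chain u≺S) ⟩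
      A                                 ∎
      where
        disjoint : ∀ {b} → b ∈ S → b ∉ ⁅ u ⁆
        disjoint b∈S b∈⁅u⁆ = ≺-irrefl (subst (u ≺_) (x∈⁅y⁆⇒x≡y u b∈⁅u⁆) (u≺S b∈S))
        S∪⁅u⁆⊆T : S ∪ ⁅ u ⁆ ⊆ T
        S∪⁅u⁆⊆T b∈ with x∈p∪q⁻ S ⁅ u ⁆ b∈
        ... | inj₁ b∈S   = S⊆T b∈S
        ... | inj₂ b∈⁅u⁆ = subst (_∈ T) (sym (x∈⁅y⁆⇒x≡y u b∈⁅u⁆)) u∈T

    chainBounded-peel : ∀ {T C u c x A} → u ∈ T → u ∈ C → Antichain C →
                        (∀ {b} → b ∈ T → b ∉ C → u ≺ b) → c ≤ x u →
                        ChainBounded T x A → ChainBounded T (peel C c x) (A - c)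
    chainBounded-peel {T} {C} {u} {c} {x} {A} u∈T u∈C antichain after c≤xu bounded {S} S⊆T chain =
      x+y≤z⇒x≤z-y (by-cases (subsingleton-cases (S ∩ C) (chain∩antichain-subsingleton chain antichain)))
      where
        x′ : Fin n → Carrier
        x′ = peel C c x

        decomposition : ∀ {P} → S ∩ C ≡ P → sumOver K S x ≡ sumOver K S x′ + c * sumOver K P (λ _ → 1#)
        decomposition refl = begin-equality
          sumOver K S x                                     ≡⟨ sumOver-cong S (λ _ → *-identityʳ _) ⟨
          sumOver K S (λ b → x b * 1#)                      ≡⟨ sumOver-peel S C c x (λ _ → 1#) ⟩
          sumOver K S (λ b → x′ b * 1#) + c * sumOver K (S ∩ C) (λ _ → 1#)
                                                            ≡⟨ cong (_+ _) (sumOver-cong S (λ _ → *-identityʳ _)) ⟩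
          sumOver K S x′ + c * sumOver K (S ∩ C) (λ _ → 1#) ∎

        by-cases : S ∩ C ≡ ⊥ ⊎ ∃[ v ] S ∩ C ≡ ⁅ v ⁆ → sumOver K S x′ + c ≤ A
        by-cases (inj₂ (v , S∩C≡⁅v⁆)) = begin
          sumOver K S x′ + c                              ≡⟨ cong (sumOver K S x′ +_) (*-identityʳ c) ⟨
          sumOver K S x′ + c * 1#                         ≡⟨ cong (λ e → sumOver K S x′ + c * e) (sumOver-⁅⁆ v _) ⟨
          sumOver K S x′ + c * sumOver K ⁅ v ⁆ (λ _ → 1#) ≡⟨ decomposition S∩C≡⁅v⁆ ⟨
          sumOver K S x                                   ≤⟨ bounded S⊆T chain ⟩
          A                                               ∎
        by-cases (inj₁ S∩C≡⊥) = begin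
          sumOver K S x′ + c  ≡⟨ cong (_+ c) x′-sum≡x-sum ⟩
          sumOver K S x + c   ≤⟨ +-monoʳ-≤ (sumOver K S x) c≤xu ⟩
          sumOver K S x + x u ≤⟨ chainBounded-extend bounded S⊆T chain u∈T u≺S ⟩
          A                   ∎
          where
            x′-sum≡x-sum : sumOver K S x′ ≡ sumOver K S x
            x′-sum≡x-sum = sym (begin-equality
              sumOver K S x                                   ≡⟨ decomposition S∩C≡⊥ ⟩
              sumOver K S x′ + c * sumOver K {n} ⊥ (λ _ → 1#) ≡⟨ cong (λ e → sumOver K S x′ + c * e) (sumOver-⊥ n _) ⟩
              sumOver K S x′ + c * 0#                         ≡⟨ cong (sumOver K S x′ +_) (zeroʳ c) ⟩
              sumOver K S x′ + 0#                             ≡⟨ +-identityʳ _ ⟩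
              sumOver K S x′                                  ∎)
            u≺S : ∀ {b} → b ∈ S → u ≺ b
            u≺S b∈S = after (S⊆T b∈S) (λ b∈C → ∉⊥ (subst (_ ∈_) S∩C≡⊥ (x∈p∩q⁺ (b∈S , b∈C))))

    startsBefore : Fin n → Subset n
    startsBefore u = toSubset (λ b → left b ≤? right u)

    ∈startsBefore-self : ∀ u → u ∈ startsBefore u
    ∈startsBefore-self u = ∈-toSubset⁺ (λ b → left b ≤? right u) (left≤right u)

    after-startsBefore : ∀ {T u b} → b ∈ T → b ∉ T ∩ startsBefore u → u ≺ b
    after-startsBefore {u = u} b∈T b∉ =
      ≰⇒> (λ lb≤ru → b∉ (x∈p∩q⁺ (b∈T , ∈-toSubset⁺ (λ b → left b ≤? right u) lb≤ru)))

    antichain-startsBefore : ∀ {T u} → (∀ {b} → b ∈ T → right u ≤ right b) →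
                             Antichain (T ∩ startsBefore u)
    antichain-startsBefore {T} {u} u-first a∈ b∈ a≺b = <⇒≱ a≺b (begin
      left _  ≤⟨ ∈-toSubset⁻ (λ b → left b ≤? right u) (proj₂ (x∈p∩q⁻ T _ b∈)) ⟩
      right u ≤⟨ u-first (proj₁ (x∈p∩q⁻ T _ a∈)) ⟩
      right _ ∎)

    chain-antichain-bound-∅ : ∀ {T x y A B} → Empty T → ChainBounded T x A → AntichainBounded T y B →
                              sumOver K T (λ b → x b * y b) ≤ A * B
    chain-antichain-bound-∅ {T} {x} {y} {A} {B} T-empty chainBounded antichainBounded = begin
      sumOver K T (λ b → x b * y b) ≡⟨ cong (λ S → sumOver K S (λ b → x b * y b)) (Empty-unique T-empty) ⟩
      sumOver K ⊥ (λ b → x b * y b) ≡⟨ sumOver-⊥ n _ ⟩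
      0#                            ≤⟨ *-nonneg 0≤A 0≤B ⟩
      A * B                         ∎
      where
        0≤A : 0# ≤ A
        0≤A = subst (_≤ A) (sumOver-⊥ n x) (chainBounded ⊥⊆ (⊥-elim ∘ ∉⊥))
        0≤B : 0# ≤ B
        0≤B = subst (_≤ B) (sumOver-⊥ n y) (antichainBounded ⊥⊆ (⊥-elim ∘ ∉⊥))

    chain-antichain-bound : ∀ {T x y A B} → (∀ {b} → b ∈ T → 0# ≤ x b) →
                            ChainBounded T x A → AntichainBounded T y B →
                            sumOver K T (λ b → x b * y b) ≤ A * B
    chain-antichain-bound {T} = go (⊂-wellFounded T)
      where
      go : ∀ {T x y A B} → Acc _⊂_ T → (∀ {b} → b ∈ T → 0# ≤ x b) →
           ChainBounded T x A → AntichainBounded T y B →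
           sumOver K T (λ b → x b * y b) ≤ A * B
      go {T} {x} {y} {A} {B} (acc smaller) x≥0 chainBounded antichainBounded with nonempty? T
      ... | no T-empty = chain-antichain-bound-∅ T-empty chainBounded antichainBounded
      ... | yes T-nonempty with ∃-minimiser right T-nonempty
      ...   | u , u∈T , u-first
            with ∃-minimiser x {T ∩ startsBefore u} (u , x∈p∩q⁺ (u∈T , ∈startsBefore-self u))
      ...   | v , v∈C , v-min = begin
        sumOver K T (λ b → x b * y b)
          ≡⟨ sumOver-peel-remove x y v∈T v∈C ⟩
        sumOver K (T ─ ⁅ v ⁆) (λ b → x′ b * y b) + c * sumOver K (T ∩ C) y
          ≤⟨ +-mono₂-≤ rest-bound (*-monoʳ-≤-nonneg (x≥0 v∈T) C-bound) ⟩
        (A - c) * B + c * B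
          ≡⟨ [x-y]z+yz≡xz A c B ⟩
        A * B ∎
        where
          C : Subset n
          C = T ∩ startsBefore u
          c : Carrier
          c = x v
          x′ : Fin n → Carrier
          x′ = peel C c x
          v∈T : v ∈ T
          v∈T = p∩q⊆p T _ v∈C
          u∈C : u ∈ C
          u∈C = x∈p∩q⁺ (u∈T , ∈startsBefore-self u)
          C-antichain : Antichain C
          C-antichain = antichain-startsBefore u-first
          T─v⊆T : T ─ ⁅ v ⁆ ⊆ T
          T─v⊆T = p─q⊆p T _
          peeled-chainBounded : ChainBounded T x′ (A - c)
          peeled-chainBounded = chainBounded-peel u∈T u∈C C-antichain
            after-startsBefore (v-min u∈C) chainBounded
          rest-bound : sumOver K (T ─ ⁅ v ⁆) (λ b → x′ b * y b) ≤ (A - c) * B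
          rest-bound = go (smaller (x∈p⇒p-x⊂p v∈T)) (peel-nonneg x≥0 v-min ∘ T─v⊆T)
            (λ S⊆ → peeled-chainBounded (⊆-trans S⊆ T─v⊆T))
            (λ C′⊆ → antichainBounded (⊆-trans C′⊆ T─v⊆T))
          C-bound : sumOver K (T ∩ C) y ≤ B
          C-bound = antichainBounded (p∩q⊆p T C) (λ a∈ b∈ → C-antichain (p∩q⊆q T C a∈) (p∩q⊆q T C b∈))

  Separated : ∀ {d n} → (Fin d → Intervals n) → Subset n → Set
  Separated B T = ∀ {a b} → a ∈ T → b ∈ T → a ≢ b → ∃[ i ] Apart (B i) a b

  volume-bound : ∀ d {n} (B : Fin d → Intervals n) (x : Fin d → Fin n → Carrier) (A : Fin d → Carrier) {T} →
                 (∀ i {b} → b ∈ T → 0# ≤ x i b) → (∀ i → ChainBounded (B i) T (x i) (A i)) → Separated B T →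
                 sumOver K T (λ b → prodAll K d (λ i → x i b)) ≤ prodAll K d A
  volume-bound zero {n} B x A {T} _ _ separated with subsingleton-cases T unique
    where
      unique : ∀ {a b} → a ∈ T → b ∈ T → a ≡ b
      unique {a} {b} a∈T b∈T with a Fin.≟ b
      ... | yes a≡b = a≡b
      ... | no a≢b with () ← proj₁ (separated a∈T b∈T a≢b)
  ... | inj₁ refl       = subst (_≤ 1#) (sym (sumOver-⊥ n (λ _ → 1#))) (proj₁ 0<1)
  ... | inj₂ (v , refl) = reflexive (sumOver-⁅⁆ v _)
  volume-bound (suc d) B x A {T} x≥0 bounded separated =
    chain-antichain-bound (B zero) (x≥0 zero) (bounded zero) antichainBounded
    where
      antichainBounded : AntichainBounded (B zero) T (λ b → prodAll K d (λ i → x (suc i) b)) (prodAll K d (A ∘ suc))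
      antichainBounded {C} C⊆T antichain =
        volume-bound d (B ∘ suc) (x ∘ suc) (A ∘ suc) (λ i → x≥0 (suc i) ∘ C⊆T)
          (λ i S⊆C → bounded (suc i) (⊆-trans S⊆C C⊆T)) separated′
        where
          separated′ : Separated (B ∘ suc) C
          separated′ a∈C b∈C a≢b with separated (C⊆T a∈C) (C⊆T b∈C) a≢b
          ... | zero  , inj₁ a≺b = ⊥-elim (antichain a∈C b∈C a≺b)
          ... | zero  , inj₂ b≺a = ⊥-elim (antichain b∈C a∈C b≺a)
          ... | suc i , apart    = i , apart

  intervals : ∀ {n} (G : Graph n) → IsIntervalGraph K G → Intervals n
  intervals _ (l , r , l≤r , _) = record { left = l ; right = r ; left≤right = l≤r }

  module _ {n} (G : Graph n) (interval : IsIntervalGraph K G) where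
    open Intervals (intervals G interval)

    edge⇔overlap : ∀ {u v} → u ≢ v → Edge G u v ⇔ (left u ≤ right v × left v ≤ right u)
    edge⇔overlap = proj₂ (proj₂ (proj₂ interval)) _ _

    chain⇒stable : ∀ {S} → Chain (intervals G interval) S → Stable G S
    chain⇒stable chain u v u∈S v∈S uv with u Fin.≟ v
    ... | yes refl = irrefl G u uv
    ... | no u≢v with Equivalence.to (edge⇔overlap u≢v) uv | chain u∈S v∈S u≢v
    ...   | _     , lv≤ru | inj₁ u≺v = <⇒≱ u≺v lv≤ru
    ...   | lu≤rv , _     | inj₂ v≺u = <⇒≱ v≺u lu≤rv

    edge? : ∀ {u v} → u ≢ v → Dec (Edge G u v)
    edge? {u} {v} u≢v = Dec.map (⇔.sym (edge⇔overlap u≢v)) (left u ≤? right v ×-dec left v ≤? right u)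

    ¬edge⇒apart : ∀ {u v} → u ≢ v → ¬ Edge G u v → Apart (intervals G interval) u v
    ¬edge⇒apart {u} {v} u≢v ¬uv with left u ≤? right v
    ... | no lu≰rv  = inj₂ (≰⇒> lu≰rv)
    ... | yes lu≤rv = inj₁ (≰⇒> (λ lv≤ru → ¬uv (Equivalence.from (edge⇔overlap u≢v) (lu≤rv , lv≤ru))))

  module _ {n d} {w : Fin n → Fin d → Carrier} (packing : PackingClass K n d w) where
    open PackingClass packing

    boxes : Fin d → Intervals n
    boxes i = intervals (G i) (interval i)

    boxes-separated : Separated boxes ⊤
    boxes-separated {a} {b} _ _ a≢b
      with ¬∀⟶∃¬ d _ (λ i → edge? (G i) (interval i) a≢b) (noCommonEdge a b a≢b)
    ... | i , ¬edge = i , ¬edge⇒apart (G i) (interval i) a≢b ¬edge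

    boxes-chainBounded : ∀ {w′} → ConservativeScale K w w′ → ∀ i → ChainBounded (boxes i) ⊤ (λ b → w′ b i) 1#
    boxes-chainBounded scale i {S} _ chain = scale i S (stableInF i S (chain⇒stable (G i) (interval i) chain))

-- The hypothesis that w takes values in [0, 1] is not needed.
corollary8 : (K : OrderedCommRing) → let open OrderedCommRing K in
    (n d : ℕ) (w w' : Fin n → Fin d → Carrier) →
    SizeFunction K n d w → NonNeg K n d w' → ConservativeScale K w w' →
    PackingClass K n d w →
    sumAll K n (λ b → prodAll K d (λ i → w' b i)) ≤ 1#
corollary8 K n d w w′ _ w′≥0 scale packing = begin
  sumAll K n (λ b → prodAll K d (w′ b))  ≡⟨ sumOver-⊤ K n _ ⟨
  sumOver K ⊤ (λ b → prodAll K d (w′ b)) ≤⟨ volume-bound K d (boxes K packing) (λ i b → w′ b i) (λ _ → 1#)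
                                              (λ i _ → w′≥0 _ i) (boxes-chainBounded K packing scale)
                                              (boxes-separated K packing) ⟩
  prodAll K d (λ _ → 1#)                 ≡⟨ prodAll-1 K d ⟩
  1#                                     ∎
  where
    open OrderedCommRing K
    open ≤-Reasoning (TotalOrder.poset (totalOrder K))
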